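{- Let $\mathcal{G}$ be a finite partial Sherk plane in which some line is incident only with thick points, let $n$ be the (constant) number of points on each line, $r$ the (constant) number of lines through each point, and $N$ the (constant) number of poles of each line. Suppose that some line $\ell$ has a pole $P$. Then $n-r+1\le N$.
   Context: A partial Sherk plane is a structure of points, lines, an incidence relation, and a binary relation $\perp$ on lines satisfying: (A*) two distinct points lie on at most one line; (B1) $\ell\perp m$ implies $m\perp\ell$; (B2) perpendicular lines intersect in at least one point; (B3) for any point $P$ and line $\ell$ there is at least one line through $P$ perpendicular to $\ell$; (B4) for any line $\ell$ and point $P$ on $\ell$ there is a unique line through $P$ perpendicular to $\ell$; (B5) there exist lines $x,y,z$ with $x\perp y$, $x\not\perp z$, $y\not\perp z$, and $x,y,z$ not all through a common point. Finite means finitely many points. A point is thick if it lies on at least three lines. A point $P$ not on a line $\ell$ is a pole of $\ell$ if more than one line through $P$ is perpendicular to $\ell$. Under the hypotheses, all lines have the same number $n$ of points, all points lie on the same number $r$ of lines, and all lines have the same number $N$ of poles. -}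

module Defs where

open import Data.Nat using (ℕ)
open import Data.List using (List; length)
open import Data.List.Membership.Propositional using (_∈_)
open import Data.List.Relation.Unary.Unique.Propositional using (Unique)
open import Data.Product using (Σ; ∃; ∃-syntax; _×_; _,_)
open import Relation.Binary.PropositionalEquality using (_≡_; _≢_)
open import Relation.Nullary using (¬_)

record PartialSherkPlane (Pt Ln : Set) : Set₁ where
  field
    _I_ : Pt → Ln → Set
    _⊥_ : Ln → Ln → Set
    axA* : ∀ {P Q ℓ m} → P ≢ Q → P I ℓ → Q I ℓ → P I m → Q I m → ℓ ≡ m
    axB1 : ∀ {ℓ m} → ℓ ⊥ m → m ⊥ ℓ
    axB2 : ∀ {ℓ m} → ℓ ⊥ m → ∃[ P ] (P I ℓ × P I m)
    axB3 : ∀ (P : Pt) (ℓ : Ln) → ∃[ m ] (P I m × m ⊥ ℓ)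
    axB4 : ∀ {P ℓ} → P I ℓ →
           ∃[ m ] ((P I m × m ⊥ ℓ) × (∀ m′ → P I m′ → m′ ⊥ ℓ → m′ ≡ m))
    axB5 : ∃[ x ] ∃[ y ] ∃[ z ]
             (x ⊥ y × ¬ (x ⊥ z) × ¬ (y ⊥ z) ×
              ¬ (∃[ P ] (P I x × P I y × P I z)))

  Thick : Pt → Set
  Thick P = ∃[ a ] ∃[ b ] ∃[ c ]
              (P I a × P I b × P I c × a ≢ b × a ≢ c × b ≢ c)

  IsPole : Pt → Ln → Set
  IsPole P ℓ = ¬ (P I ℓ) × ∃[ m ] ∃[ m′ ] (m ≢ m′ × P I m × m ⊥ ℓ × P I m′ × m′ ⊥ ℓ)

FiniteType : Set → Set
FiniteType A = ∃[ xs ] (∀ (x : A) → x ∈ xs)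

HasCount : {A : Set} → (A → Set) → ℕ → Set
HasCount {A} Q k = ∃[ xs ] (Unique xs × (∀ (x : A) → (x ∈ xs → Q x) × (Q x → x ∈ xs)) × length xs ≡ k)

module Submission where

-- First, every line k through the pole P is perpendicular to ℓ:
-- otherwise the perpendicular projection of k onto ℓ is injective and misses
-- the foot of a second perpendicular from P, so ℓ would have n + 1 points.
-- Second, send each point X of ℓ to a line through P (if XP is a line) or else
-- to the corner W where the perpendicular m at X to ℓ meets the perpendicular
-- from P to m; W is then a pole of ℓ.  This map is injective, and never hits
-- the pole P itself, so n + 1 ≤ r + N.
--
-- Incidence is not decidable, so both steps are carried out under double
-- negation, which is removed at the end because ≤ on ℕ is decidable.

open import Defs
open import Level using (0ℓ)
open import Data.Nat using (ℕ; _+_; _≤_; _<_; suc; z≤n; s≤s; _<?_)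
open import Data.Nat.Properties using (+-comm; <-irrefl)
open import Data.Product using (∃-syntax; _×_; _,_; proj₁; proj₂)
open import Data.Sum using (_⊎_; inj₁; inj₂; [_,_]′)
open import Data.Sum.Properties using (inj₁-injective; inj₂-injective)
open import Data.List using (List; []; _∷_; map; length; _++_; removeAt)
open import Data.List.Properties using (length-map; length-++; length-removeAt′)
open import Data.List.Relation.Unary.Any using (here; there; index)
open import Data.List.Relation.Unary.All as All using (All; []; _∷_)
open import Data.List.Relation.Unary.All.Properties as All using ()
open import Data.List.Relation.Unary.AllPairs using ([]; _∷_)
open import Data.List.Relation.Unary.Unique.Propositional using (Unique)
open import Data.List.Membership.Propositional using (_∈_)
open import Data.List.Membership.Propositional.Properties using (∈-map⁺; ∈-map⁻; ∈-++⁺ˡ; ∈-++⁺ʳ)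
open import Effect.Monad using (RawMonad)
open import Relation.Binary.PropositionalEquality
  using (_≡_; _≢_; refl; sym; trans; cong; cong₂; subst; subst₂; ≢-sym)
open import Relation.Nullary using (¬_; Dec; yes; no; ¬¬-excluded-middle; decidable-stable; contradiction)
open import Relation.Nullary.Negation using (¬¬-Monad; ¬¬-map)

AtMost : {A : Set} → (A → Set) → ℕ → Set
AtMost {A} R b = ∃[ ys ] ((∀ (y : A) → R y → y ∈ ys) × length ys ≡ b)

private
  variable
    A B : Set

exactly⇒atMost : {Q : A → Set} {a : ℕ} → HasCount Q a → AtMost Q a
exactly⇒atMost (xs , _ , spec , len) = xs , (λ x → proj₂ (spec x)) , len

∈-removeAt : {ys : List A} {w z : A} → w ∈ ys → (z∈ : z ∈ ys) → w ≢ z →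
             w ∈ removeAt ys (index z∈)
∈-removeAt (here w≡y) (here z≡y) w≢z = contradiction (trans w≡y (sym z≡y)) w≢z
∈-removeAt (there w∈) (here _)   _   = w∈
∈-removeAt (here w≡y) (there _)  _   = here w≡y
∈-removeAt (there w∈) (there z∈) w≢z = there (∈-removeAt w∈ z∈ w≢z)

unique-⊆⇒length≤ : {zs ys : List A} → Unique zs → (∀ {z} → z ∈ zs → z ∈ ys) →
                   length zs ≤ length ys
unique-⊆⇒length≤ {zs = []} _ _ = z≤n
unique-⊆⇒length≤ {zs = z ∷ zs} {ys} (z∉zs ∷ unique) zs⊆ys =
  subst (suc (length zs) ≤_) (sym (length-removeAt′ ys (index z∈ys)))
    (s≤s (unique-⊆⇒length≤ unique λ w∈ →
      ∈-removeAt (zs⊆ys (there w∈)) z∈ys (≢-sym (All.lookup z∉zs w∈))))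
  where z∈ys = zs⊆ys (here refl)

count-<-by-injection :
  {Q : A → Set} {R : B → Set} {a b : ℕ} →
  HasCount Q a → AtMost R b → (f : A → B) →
  (∀ {x} → Q x → R (f x)) →
  (∀ {x y} → Q x → Q y → x ≢ y → f x ≢ f y) →
  (b₀ : B) → R b₀ → (∀ {x} → Q x → f x ≢ b₀) → a < b
count-<-by-injection {Q = Q} (xs , unique , spec , refl) (ys , listed , refl)
                     f maps-into injective b₀ Rb₀ avoids =
  subst (λ k → suc k ≤ length ys) (length-map f xs)
    (unique-⊆⇒length≤ ((All.map⁺ (All.tabulate λ x∈ → ≢-sym (avoids (inQ x∈))))
                        ∷ unique-map (All.tabulate inQ) unique)
                      image⊆ys)
  where
  inQ : ∀ {x} → x ∈ xs → Q x
  inQ {x} = proj₁ (spec x)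

  unique-map : ∀ {zs} → All Q zs → Unique zs → Unique (map f zs)
  unique-map []         []          = []
  unique-map (qz ∷ qzs) (z∉ ∷ uniq) =
    All.map⁺ (All.zipWith (λ (qy , z≢y) → injective qz qy z≢y) (qzs , z∉))
    ∷ unique-map qzs uniq

  image⊆ys : ∀ {y} → y ∈ b₀ ∷ map f xs → y ∈ ys
  image⊆ys (here refl) = listed b₀ Rb₀
  image⊆ys (there y∈)  with ∈-map⁻ f y∈
  ... | x , x∈ , refl = listed (f x) (maps-into (inQ x∈))

atMost-⊎ : {Q : A → Set} {R : B → Set} {a b : ℕ} →
           AtMost Q a → AtMost R b → AtMost [ Q , R ]′ (a + b)
atMost-⊎ {Q = Q} {R = R} (xs , listedˣ , refl) (ys , listedʸ , refl) =
  map inj₁ xs ++ map inj₂ ys , listed , length-both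
  where
  listed : ∀ z → [ Q , R ]′ z → z ∈ map inj₁ xs ++ map inj₂ ys
  listed (inj₁ x) qx = ∈-++⁺ˡ (∈-map⁺ inj₁ (listedˣ x qx))
  listed (inj₂ y) ry = ∈-++⁺ʳ (map inj₁ xs) (∈-map⁺ inj₂ (listedʸ y ry))

  length-both : length (map inj₁ xs ++ map inj₂ ys) ≡ length xs + length ys
  length-both = trans (length-++ (map inj₁ xs))
                      (cong₂ _+_ (length-map inj₁ xs) (length-map inj₂ ys))

¬¬-∀-∈ : {xs : List A} {R : A → Set} →
         (∀ {x} → x ∈ xs → ¬ ¬ R x) → ¬ ¬ (∀ {x} → x ∈ xs → R x)
¬¬-∀-∈ each = ¬¬-map All.lookup (All.sequenceM 0ℓ ¬¬-Monad (All.tabulate each))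

¬¬-∀-counted : {Q R : A → Set} {a : ℕ} → HasCount Q a →
               (∀ {x} → Q x → ¬ ¬ R x) → ¬ ¬ (∀ {x} → Q x → R x)
¬¬-∀-counted (xs , _ , spec , _) each =
  ¬¬-map (λ all {x} qx → all (proj₂ (spec x) qx))
         (¬¬-∀-∈ λ {x} x∈ → each (proj₁ (spec x) x∈))

¬¬-decidable-finite : FiniteType A → (R : A → Set) → ¬ ¬ (∀ x → Dec (R x))
¬¬-decidable-finite (_ , listed) _ =
  ¬¬-map (λ all x → all (listed x)) (¬¬-∀-∈ λ _ → ¬¬-excluded-middle)

module SherkGeometry {Pt Ln : Set} (G : PartialSherkPlane Pt Ln) where
  open PartialSherkPlane G

  private
    variable
      P X X′ Y Z : Pt
      k ℓ m m′ : Ln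
      a b n r N : ℕ

  perp : Pt → Ln → Ln
  perp X ℓ = proj₁ (axB3 X ℓ)

  perp-through : ∀ X ℓ → X I perp X ℓ
  perp-through X ℓ = proj₁ (proj₂ (axB3 X ℓ))

  perp-⊥ : ∀ X ℓ → perp X ℓ ⊥ ℓ
  perp-⊥ X ℓ = proj₂ (proj₂ (axB3 X ℓ))

  foot : Pt → Ln → Pt
  foot X ℓ = proj₁ (axB2 (perp-⊥ X ℓ))

  foot-on-perp : ∀ X ℓ → foot X ℓ I perp X ℓ
  foot-on-perp X ℓ = proj₁ (proj₂ (axB2 (perp-⊥ X ℓ)))

  foot-on-line : ∀ X ℓ → foot X ℓ I ℓ
  foot-on-line X ℓ = proj₂ (proj₂ (axB2 (perp-⊥ X ℓ)))

  perp-unique : Y I ℓ → Y I m → m ⊥ ℓ → Y I m′ → m′ ⊥ ℓ → m ≡ m′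
  perp-unique Yℓ Ym m⊥ℓ Ym′ m′⊥ℓ with axB4 Yℓ
  ... | _ , _ , unique = trans (unique _ Ym m⊥ℓ) (sym (unique _ Ym′ m′⊥ℓ))

  -- A line with a pole is not self-perpendicular: otherwise ℓ would be the
  -- only perpendicular to ℓ through any of its points, and the pole would lie on ℓ.
  pole⇒¬self-perp : IsPole P ℓ → ¬ (ℓ ⊥ ℓ)
  pole⇒¬self-perp {P} (P∉ℓ , m , _ , _ , Pm , m⊥ℓ , _) ℓ⊥ℓ with axB2 m⊥ℓ
  ... | Y , Ym , Yℓ = P∉ℓ (subst (P I_) (perp-unique Yℓ Ym m⊥ℓ Yℓ ℓ⊥ℓ) Pm)

  pole-other-perp : IsPole P ℓ → (m : Ln) → ¬ ¬ (∃[ m′ ] (P I m′ × m′ ⊥ ℓ × m′ ≢ m))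
  pole-other-perp (_ , m₁ , m₂ , m₁≢m₂ , Pm₁ , m₁⊥ℓ , Pm₂ , m₂⊥ℓ) m none =
    none (m₁ , Pm₁ , m₁⊥ℓ , λ m₁≡m →
      none (m₂ , Pm₂ , m₂⊥ℓ , λ m₂≡m → m₁≢m₂ (trans m₁≡m (sym m₂≡m))))

  -- Projection onto ℓ is injective on the points of a line k not perpendicular
  -- to ℓ: two points of k with the same foot would span that foot's perpendicular.
  projection-injective : ¬ (k ⊥ ℓ) → Y I k → Z I k → Y ≢ Z → foot Y ℓ ≢ foot Z ℓ
  projection-injective {k} {ℓ} {Y} {Z} k⊥̸ℓ Yk Zk Y≢Z same-foot =
    k⊥̸ℓ (subst (_⊥ ℓ) (sym k≡perp) (perp-⊥ Y ℓ))
    where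
    same-perp : perp Y ℓ ≡ perp Z ℓ
    same-perp = perp-unique (foot-on-line Z ℓ)
                  (subst (_I perp Y ℓ) same-foot (foot-on-perp Y ℓ)) (perp-⊥ Y ℓ)
                  (foot-on-perp Z ℓ) (perp-⊥ Z ℓ)

    k≡perp : k ≡ perp Y ℓ
    k≡perp = axA* Y≢Z Yk Zk (perp-through Y ℓ)
                  (subst (Z I_) (sym same-perp) (perp-through Z ℓ))

  projection-bound : ¬ (k ⊥ ℓ) → P I k → P I m′ → m′ ⊥ ℓ → m′ ≢ perp P ℓ →
                     HasCount (_I k) a → AtMost (_I ℓ) b → a < b
  projection-bound {k} {ℓ} {P} {m′} k⊥̸ℓ Pk Pm′ m′⊥ℓ m′≢perp points-k points-ℓ
    with axB2 m′⊥ℓ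
  ... | W , Wm′ , Wℓ =
    count-<-by-injection points-k points-ℓ (λ Y → foot Y ℓ) (λ {Y} _ → foot-on-line Y ℓ)
      (projection-injective k⊥̸ℓ) W Wℓ misses
    where
    -- A point Y of k with foot W lies on m′ (its perpendicular is m′); Y = P
    -- would force m′ = perp P ℓ, and Y ≠ P would force k = m′.
    misses : Y I k → foot Y ℓ ≢ W
    misses {Y} Yk foot≡W = ¬¬-excluded-middle λ where
        (yes Y≡P) → m′≢perp (trans (sym perp≡m′) (cong (λ Z → perp Z ℓ) Y≡P))
        (no Y≢P)  → k⊥̸ℓ (subst (_⊥ ℓ) (sym (axA* Y≢P Yk Pk Ym′ Pm′)) m′⊥ℓ)
      where
      perp≡m′ : perp Y ℓ ≡ m′
      perp≡m′ = perp-unique Wℓ (subst (_I perp Y ℓ) foot≡W (foot-on-perp Y ℓ))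
                  (perp-⊥ Y ℓ) Wm′ m′⊥ℓ

      Ym′ : Y I m′
      Ym′ = subst (Y I_) perp≡m′ (perp-through Y ℓ)

  pole-pencil-⊥ : (∀ l → HasCount (_I l) n) → IsPole P ℓ → P I k → ¬ ¬ (k ⊥ ℓ)
  pole-pencil-⊥ {ℓ = ℓ} {k = k} points pole Pk k⊥̸ℓ =
    pole-other-perp pole (perp _ ℓ) λ (m′ , Pm′ , m′⊥ℓ , m′≢perp) →
      <-irrefl refl (projection-bound k⊥̸ℓ Pk Pm′ m′⊥ℓ m′≢perp
                       (points k) (exactly⇒atMost (points ℓ)))

  Joined : Pt → Pt → Set
  Joined P X = ∃[ k ] (P I k × X I k)

  module PoleImage (pole : IsPole P ℓ) (pencil-⊥ : ∀ {k} → P I k → k ⊥ ℓ)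
                   (joined? : ∀ X → Dec (Joined P X)) where

    normal : Pt → Ln
    normal X = perp X ℓ

    dropped : Pt → Ln
    dropped X = perp P (normal X)

    corner : Pt → Pt
    corner X = foot P (normal X)

    corner-on-normal : ∀ X → corner X I normal X
    corner-on-normal X = foot-on-line P (normal X)

    corner-on-dropped : ∀ X → corner X I dropped X
    corner-on-dropped X = foot-on-perp P (normal X)

    corner≢P : ¬ Joined P X → corner X ≢ P
    corner≢P {X} unjoined W≡P =
      unjoined (normal X , subst (_I normal X) W≡P (corner-on-normal X) , perp-through X ℓ)

    -- The corner is off ℓ: it is not X (X is not on the dropped line through P),
    -- and any other point of ℓ on the normal would make the normal equal ℓ.
    corner∉ℓ : X I ℓ → ¬ Joined P X → ¬ (corner X I ℓ)
    corner∉ℓ {X} Xℓ unjoined Wℓ = ¬¬-excluded-middle λ where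
      (yes W≡X) → unjoined (dropped X , perp-through P (normal X)
                           , subst (_I dropped X) W≡X (corner-on-dropped X))
      (no W≢X)  → pole⇒¬self-perp pole
                    (subst (_⊥ ℓ) (sym (axA* W≢X Wℓ Xℓ (corner-on-normal X) (perp-through X ℓ)))
                       (perp-⊥ X ℓ))

    -- The corner of an unjoined point of ℓ is a pole of ℓ: the normal and the
    -- dropped line are two distinct perpendiculars to ℓ through it.
    corner-pole : X I ℓ → ¬ Joined P X → IsPole (corner X) ℓ
    corner-pole {X} Xℓ unjoined =
      corner∉ℓ Xℓ unjoined , normal X , dropped X , normal≢dropped
      , corner-on-normal X , perp-⊥ X ℓ
      , corner-on-dropped X , pencil-⊥ (perp-through P (normal X))
      where
      normal≢dropped : normal X ≢ dropped X
      normal≢dropped eq =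
        unjoined (normal X , subst (P I_) (sym eq) (perp-through P (normal X)) , perp-through X ℓ)

    -- Distinct unjoined points of ℓ have distinct corners: a common corner W ≠ P
    -- forces equal dropped lines, hence equal normals, hence normal = ℓ.
    corner-injective : X I ℓ → X′ I ℓ → X ≢ X′ → ¬ Joined P X → corner X ≢ corner X′
    corner-injective {X} {X′} Xℓ X′ℓ X≢X′ unjoined W≡W′ =
      pole⇒¬self-perp pole (subst (_⊥ ℓ) (sym ℓ≡normal) (perp-⊥ X ℓ))
      where
      same-dropped : dropped X ≡ dropped X′
      same-dropped = axA* (corner≢P unjoined)
        (corner-on-dropped X) (perp-through P (normal X))
        (subst (_I dropped X′) (sym W≡W′) (corner-on-dropped X′)) (perp-through P (normal X′))

      same-normal : normal X ≡ normal X′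
      same-normal = perp-unique (corner-on-dropped X)
        (corner-on-normal X) (axB1 (perp-⊥ P (normal X)))
        (subst (_I normal X′) (sym W≡W′) (corner-on-normal X′))
        (subst (normal X′ ⊥_) (sym same-dropped) (axB1 (perp-⊥ P (normal X′))))

      ℓ≡normal : ℓ ≡ normal X
      ℓ≡normal = axA* X≢X′ Xℓ X′ℓ (perp-through X ℓ)
                   (subst (X′ I_) (sym same-normal) (perp-through X′ ℓ))

    Target : Ln ⊎ Pt → Set
    Target = [ P I_ , (λ Y → IsPole Y ℓ) ]′

    image : Pt → Ln ⊎ Pt
    image X with joined? X
    ... | yes (k , _) = inj₁ k
    ... | no _        = inj₂ (corner X)

    image-target : X I ℓ → Target (image X)
    image-target {X} Xℓ with joined? X
    ... | yes (_ , Pk , _) = Pk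
    ... | no unjoined      = corner-pole Xℓ unjoined

    -- Two points of ℓ joined by the same line to P would put P on ℓ.
    image-injective : X I ℓ → X′ I ℓ → X ≢ X′ → image X ≢ image X′
    image-injective {X} {X′} Xℓ X′ℓ X≢X′ with joined? X | joined? X′
    ... | yes (k , Pk , Xk) | yes (_ , _ , X′k′) = λ same →
      proj₁ pole (subst (P I_)
        (axA* X≢X′ Xk (subst (X′ I_) (sym (inj₁-injective same)) X′k′) Xℓ X′ℓ) Pk)
    ... | yes _        | no _ = λ ()
    ... | no _         | yes _ = λ ()
    ... | no unjoined  | no _ = λ same → corner-injective Xℓ X′ℓ X≢X′ unjoined (inj₂-injective same)

    image≢P : image X ≢ inj₂ P
    image≢P {X} with joined? X
    ... | yes _       = λ ()
    ... | no unjoined = λ same → corner≢P unjoined (inj₂-injective same)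

    pole-count-bound : HasCount (_I ℓ) n → HasCount (P I_) r →
                       HasCount (λ Y → IsPole Y ℓ) N → n < r + N
    pole-count-bound points-ℓ pencil poles =
      count-<-by-injection points-ℓ (atMost-⊎ (exactly⇒atMost pencil) (exactly⇒atMost poles))
        image image-target image-injective (inj₂ P) pole (λ _ → image≢P)

  pole-bound : FiniteType Pt → (∀ l → HasCount (_I l) n) → HasCount (P I_) r →
               HasCount (λ Y → IsPole Y ℓ) N → IsPole P ℓ → ¬ ¬ (n < r + N)
  pole-bound {P = P} finite points pencil poles pole = do
    pencil-⊥  ← ¬¬-∀-counted pencil (pole-pencil-⊥ points pole)
    joined?   ← ¬¬-decidable-finite finite (Joined P)
    pure (PoleImage.pole-count-bound pole pencil-⊥ joined? (points _) pencil poles)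
    where open RawMonad ¬¬-Monad

open PartialSherkPlane using (_I_; Thick; IsPole)

lemma3p21 : {Pt Ln : Set} (G : PartialSherkPlane Pt Ln) →
    FiniteType Pt →
    (∃[ ℓ₀ ] (∀ (Q : Pt) → _I_ G Q ℓ₀ → Thick G Q)) →
    (n r N : ℕ) →
    (∀ (ℓ : Ln) → HasCount (λ Q → _I_ G Q ℓ) n) →
    (∀ (Q : Pt) → HasCount (λ ℓ → _I_ G Q ℓ) r) →
    (∀ (ℓ : Ln) → HasCount (λ Q → IsPole G Q ℓ) N) →
    (∃[ ℓ ] ∃[ P ] IsPole G P ℓ) →
    n + 1 ≤ N + r
lemma3p21 G finite _ n r N points pencil poles (ℓ , P , pole) =
  subst₂ _≤_ (+-comm 1 n) (+-comm r N)
    (decidable-stable (n <? r + N)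
      (SherkGeometry.pole-bound G finite points (pencil P) (poles ℓ) pole))
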